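{- Let $d\ge1$, integers $1\le k_1\le\dots\le k_d$, and $2\le k\le k_1+\dots+k_d$. Let $\mathcal M$ be the linear map on $\mathbb R^{2(k-1)}$, with coordinates indexed by symbols $q(1),\dots,q(k-1),t(1),\dots,t(k-1)$, given by $(\mathcal Mv)_{q(l)}=(1-\alpha_l)v_{t(l)}+\frac{l+2}{l+1}(1-\beta_{l+1})v_{q(l+1)}$ for $1\le l\le k-2$; $(\mathcal Mv)_{q(k-1)}=(1-\alpha_{k-1})v_{t(k-1)}$; $(\mathcal Mv)_{t(l)}=\frac{l+1}{l}\beta_lv_{q(l)}+\alpha_{l-1}v_{t(l-1)}$ for $2\le l\le k-1$; $(\mathcal Mv)_{t(1)}=2\beta_1v_{q(1)}$. Let $v$ be given by $v_{q(l)}=\mathcal K_l/(l+1)$ and $v_{t(l)}=n_l$ for $1\le l<k$. Then $\mathcal Mv=v$.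
   Context: $\mathbb N=\{0,1,\dots\}$, $|\mathbf a|=\sum_m a_m$. $\mathcal D_l:=\{\mathbf a\in\mathbb N^d:a_m\le k_m\ \forall m,\ 1\le|\mathbf a|\le l\}$, $n_l:=|\mathcal D_l|$, $\mathcal K_l:=\sum_{\mathbf a\in\mathcal D_l}|\mathbf a|$. For $1\le l<k$, $\alpha_l$ is defined by $\frac{n_k}{n_l}=\alpha_l\frac{n_k}{n_{l+1}}+(1-\alpha_l)\frac{\mathcal K_k}{\mathcal K_l}$; for $1<l<k$, $\beta_l$ is defined by $\frac{\mathcal K_k}{\mathcal K_l}=(1-\beta_l)\frac{\mathcal K_k}{\mathcal K_{l-1}}+\beta_l\frac{n_k}{n_l}$; and $\beta_1:=1$. -}

module Defs where

open import Data.Nat as ℕ using (ℕ; zero; suc; _≤ᵇ_; _≤_; _<_)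
open import Data.Bool using (Bool; true; false; if_then_else_; _∧_)
open import Data.List using (List; []; _∷_; map; concatMap; upTo)
import Data.Nat.ListAction as L
open import Data.Vec using (Vec; []; _∷_)
import Data.Vec as V
open import Data.Integer using (+_)
open import Data.Rational using (ℚ; 0ℚ; 1ℚ; _+_; _*_; _-_; _/_)

box : ∀ {d} → Vec ℕ d → List (Vec ℕ d)
box []       = [] ∷ []
box (k ∷ ks) = concatMap (λ a → map (a ∷_) (box ks)) (upTo (suc k))

∣_∣ᵥ : ∀ {d} → Vec ℕ d → ℕ
∣ a ∣ᵥ = V.sum a

inD : ∀ {d} → ℕ → Vec ℕ d → Bool
inD l a = (1 ≤ᵇ ∣ a ∣ᵥ) ∧ (∣ a ∣ᵥ ≤ᵇ l)

nD : ∀ {d} → Vec ℕ d → ℕ → ℕ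
nD ks l = L.sum (map (λ a → if inD l a then 1 else 0) (box ks))

KD : ∀ {d} → Vec ℕ d → ℕ → ℕ
KD ks l = L.sum (map (λ a → if inD l a then ∣ a ∣ᵥ else 0) (box ks))

-- ratio of natural numbers as a rational; (junk value 0 if the denominator
-- is 0, which never happens for the uses below since n_l, K_l > 0 for l ≥ 1)
_÷ℕ_ : ℕ → ℕ → ℚ
m ÷ℕ zero    = 0ℚ
m ÷ℕ (suc n) = (+ m) / suc n

ℕ→ℚ : ℕ → ℚ
ℕ→ℚ m = (+ m) / 1

-- The linear map 𝓜 on ℝ^{2(k-1)} (over ℚ), with coordinates q(l), t(l),
-- 1 ≤ l ≤ k-1, represented as functions ℕ → ℚ (only l ∈ [1,k-1] matter).
Mq : (k : ℕ) (α β : ℕ → ℚ) (vq vt : ℕ → ℚ) → ℕ → ℚ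
Mq k α β vq vt l with suc l ℕ.<ᵇ k
... | true  = (1ℚ - α l) * vt l
              + ((+ (l ℕ.+ 2)) / suc l) * ((1ℚ - β (suc l)) * vq (suc l))
... | false = (1ℚ - α l) * vt l

Mt : (k : ℕ) (α β : ℕ → ℚ) (vq vt : ℕ → ℚ) → ℕ → ℚ
Mt k α β vq vt zero          = 0ℚ
Mt k α β vq vt (suc zero)    = ℕ→ℚ 2 * (β 1 * vq 1)
Mt k α β vq vt l@(suc (suc m)) =
  ((+ (suc l)) / l) * (β l * vq l) + α (suc m) * vt (suc m)

-- Fix l and write u = n_k/n_{l+1}, w = K_k/K_l. The relation defining α_l says
-- (1 - α_l)(u - w) = u - n_k/n_l, and the one defining β_{l+1} says (1 - β_{l+1})(u - w) = u - K_k/K_{l+1}.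
-- Hence, multiplied by u - w, the coordinates q(l) and t(l+1) of 𝓜v = v both reduce to the counting
-- identity K_{l+1} - K_l = (l+1)(n_{l+1} - n_l): every vector of size l + 1 adds l + 1 to K.
-- The factor u - w is non-zero because n_k K_l ≤ K_k n_l < K_k n_{l+1}: the mean size over D_l is at
-- most the mean size over D_k, and the box contains a vector of size l + 1. The coordinate q(k-1) is
-- the same computation with β_k = 1 (there u = 1), and t(1) is the identity K_1 = n_1.

module Submission where

open import Defs
open import Data.Nat using (ℕ; zero; suc; _≤_; _<_; _∸_; _⊓_; _≤ᵇ_; _<ᵇ_; z≤n; s≤s; s≤s⁻¹; >-nonZero)
import Data.Nat as ℕ
import Data.Nat.Properties as ℕ
open import Data.Fin using (Fin)
import Data.Fin as F
open import Data.Vec using (Vec; lookup)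
import Data.Vec as V
open import Data.Product using (_×_; _,_; ∃-syntax)
open import Data.Bool using (true; false; if_then_else_; _∧_)
open import Data.Empty using (⊥-elim)
open import Data.List using (List; []; _∷_; map)
open import Data.List.Membership.Propositional using (_∈_; lose)
open import Data.List.Membership.Propositional.Properties using (∈-concatMap⁺; ∈-map⁺; ∈-upTo⁺)
open import Data.List.Properties using (map-cong)
open import Data.List.Relation.Unary.Any using (here; there)
open import Relation.Binary.PropositionalEquality using (_≡_; _≢_; refl; sym; trans; cong; cong₂; subst; module ≡-Reasoning)
open import Relation.Nullary.Reflects using (ofʸ; ofⁿ)

-- Natural-number arithmetic is opened only in this block: below, _+_ and _*_ are the rational operations.
module _ where

  open import Data.Nat using (_+_; _*_)
  open import Data.Vec using ([]; _∷_)
  open import Data.Nat.ListAction using (sum)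
  open import Data.Nat.Properties
  open import Data.Nat.Tactic.RingSolver using (solve-∀)
  open import Algebra.Properties.CommutativeSemigroup +-commutativeSemigroup using () renaming (interchange to +-interchange)

  module _ {A : Set} where

    sumOver : List A → (A → ℕ) → ℕ
    sumOver xs f = sum (map f xs)

    sumOver-+ : ∀ xs (f g : A → ℕ) → sumOver xs f + sumOver xs g ≡ sumOver xs (λ a → f a + g a)
    sumOver-+ []       f g = refl
    sumOver-+ (x ∷ xs) f g =
      trans (+-interchange (f x) (sumOver xs f) (g x) (sumOver xs g))
            (cong (f x + g x +_) (sumOver-+ xs f g))

    sumOver-* : ∀ xs c (f : A → ℕ) → c * sumOver xs f ≡ sumOver xs (λ a → c * f a)
    sumOver-* []       c f = *-zeroʳ c
    sumOver-* (x ∷ xs) c f = trans (*-distribˡ-+ c (f x) (sumOver xs f)) (cong (c * f x +_) (sumOver-* xs c f))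

    sumOver-mono-≤ : ∀ xs {f g : A → ℕ} → (∀ a → f a ≤ g a) → sumOver xs f ≤ sumOver xs g
    sumOver-mono-≤ []       f≤g = z≤n
    sumOver-mono-≤ (x ∷ xs) f≤g = +-mono-≤ (f≤g x) (sumOver-mono-≤ xs f≤g)

    sumOver-mono-< : ∀ {xs x} {f g : A → ℕ} →
      (∀ a → f a ≤ g a) → x ∈ xs → f x < g x → sumOver xs f < sumOver xs g
    sumOver-mono-< {_ ∷ xs} f≤g (here refl) fx<gx = +-mono-<-≤ fx<gx (sumOver-mono-≤ xs f≤g)
    sumOver-mono-< {y ∷ _}  f≤g (there x∈xs) fx<gx = +-mono-≤-< (f≤g y) (sumOver-mono-< f≤g x∈xs fx<gx)

  ∃-box-size : ∀ {d} (ks : Vec ℕ d) {s} → s ≤ ∣ ks ∣ᵥ → ∃[ a ] (a ∈ box ks × ∣ a ∣ᵥ ≡ s)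
  ∃-box-size []       z≤n = [] , here refl , refl
  ∃-box-size (k ∷ ks) {s} s≤k+∣ks∣ with ∃-box-size ks (m≤n+o⇒m∸n≤o s k s≤k+∣ks∣)
  ... | a , a∈box , ∣a∣≡s∸k =
    k ⊓ s ∷ a ,
    ∈-concatMap⁺ _ (lose (∈-upTo⁺ (s≤s (m⊓n≤m k s))) (∈-map⁺ (k ⊓ s ∷_) a∈box)) ,
    trans (cong (k ⊓ s +_) ∣a∣≡s∸k) (m⊓n+n∸m≡n k s)

  -- nD ks l and KD ks l unfold to the sums of indicator l and weight l over the sizes of the vectors of box ks.
  indicator weight : ℕ → ℕ → ℕ
  indicator l s = if (1 ≤ᵇ s) ∧ (s ≤ᵇ l) then 1 else 0
  weight    l s = if (1 ≤ᵇ s) ∧ (s ≤ᵇ l) then s else 0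

  indicator-mono : ∀ {l m} s → l ≤ m → indicator l s ≤ indicator m s
  indicator-mono zero l≤m = z≤n
  indicator-mono {l} {m} (suc t) l≤m
    with suc t ≤ᵇ l | ≤ᵇ-reflects-≤ (suc t) l | suc t ≤ᵇ m | ≤ᵇ-reflects-≤ (suc t) m
  ... | true  | ofʸ _   | true  | _       = ≤-refl
  ... | true  | ofʸ t<l | false | ofⁿ t≮m = ⊥-elim (t≮m (≤-trans t<l l≤m))
  ... | false | _       | _     | _       = z≤n

  indicator-suc-< : ∀ l → indicator l (suc l) < indicator (suc l) (suc l)
  indicator-suc-< l
    with suc l ≤ᵇ l | ≤ᵇ-reflects-≤ (suc l) l | suc l ≤ᵇ suc l | ≤ᵇ-reflects-≤ (suc l) (suc l)
  ... | true  | ofʸ sl≤l | _     | _         = ⊥-elim (<-irrefl refl sl≤l)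
  ... | false | _        | true  | _         = s≤s z≤n
  ... | false | _        | false | ofⁿ sl≰sl = ⊥-elim (sl≰sl ≤-refl)

  indicator≤weight : ∀ l s → indicator l s ≤ weight l s
  indicator≤weight l zero = z≤n
  indicator≤weight l (suc t) with suc t ≤ᵇ l
  ... | true  = s≤s z≤n
  ... | false = z≤n

  weight≤*indicator : ∀ l s → weight l s ≤ l * indicator l s
  weight≤*indicator l zero = z≤n
  weight≤*indicator l (suc t) with suc t ≤ᵇ l | ≤ᵇ-reflects-≤ (suc t) l
  ... | true  | ofʸ t<l = subst (suc t ≤_) (sym (*-identityʳ l)) t<l
  ... | false | _       = z≤n

  weight-1 : ∀ s → weight 1 s ≡ indicator 1 s
  weight-1 zero          = refl
  weight-1 (suc zero)    = refl
  weight-1 (suc (suc _)) = refl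

  -- A size in (l, m] has weight at least l + 1.
  weight-gap : ∀ {l m} s → l ≤ m →
    weight l s + suc l * indicator m s ≤ weight m s + suc l * indicator l s
  weight-gap zero l≤m = ≤-refl
  weight-gap {l} {m} (suc t) l≤m
    with suc t ≤ᵇ l | ≤ᵇ-reflects-≤ (suc t) l | suc t ≤ᵇ m | ≤ᵇ-reflects-≤ (suc t) m
  ... | true  | _       | true  | _       = ≤-refl
  ... | true  | ofʸ t<l | false | ofⁿ t≮m = ⊥-elim (t≮m (≤-trans t<l l≤m))
  ... | false | ofⁿ t≮l | true  | _       = begin
        suc l * 1           ≡⟨ *-identityʳ (suc l) ⟩
        suc l               ≤⟨ ≰⇒> t≮l ⟩
        suc t               ≡⟨ +-identityʳ (suc t) ⟨
        suc t + 0           ≡⟨ cong (suc t +_) (*-zeroʳ (suc l)) ⟨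
        suc t + suc l * 0   ∎
    where open ≤-Reasoning
  ... | false | _       | false | _       = ≤-refl

  weight-suc : ∀ l s → weight (suc l) s + suc l * indicator l s ≡ weight l s + suc l * indicator (suc l) s
  weight-suc l zero = refl
  weight-suc l (suc t)
    with suc t ≤ᵇ l | ≤ᵇ-reflects-≤ (suc t) l | suc t ≤ᵇ suc l | ≤ᵇ-reflects-≤ (suc t) (suc l)
  ... | true  | _       | true  | _        = refl
  ... | true  | ofʸ t<l | false | ofⁿ t≰sl = ⊥-elim (t≰sl (m≤n⇒m≤1+n t<l))
  ... | false | ofⁿ t≮l | true  | ofʸ t≤l  with ≤-antisym (s≤s⁻¹ t≤l) (s≤s⁻¹ (≰⇒> t≮l))
  ...   | refl = begin
        suc l + suc l * 0   ≡⟨ cong (suc l +_) (*-zeroʳ (suc l)) ⟩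
        suc l + 0           ≡⟨ +-identityʳ (suc l) ⟩
        suc l               ≡⟨ *-identityʳ (suc l) ⟨
        suc l * 1           ∎
    where open ≡-Reasoning
  weight-suc l (suc t) | false | _ | false | _ = refl

  mean-mono : ∀ l {nl nm Kl Km} → nl ≤ nm → Kl ≤ l * nl →
    Kl + suc l * nm ≤ Km + suc l * nl → nm * Kl ≤ Km * nl
  mean-mono l {nl} {Kl = Kl} {Km} nl≤nm Kl≤l*nl gap with m≤n⇒∃[o]m+o≡n nl≤nm
  ... | δ , refl = begin
    (nl + δ) * Kl              ≡⟨ *-distribʳ-+ Kl nl δ ⟩
    nl * Kl + δ * Kl           ≤⟨ +-monoʳ-≤ (nl * Kl) (*-monoʳ-≤ δ (≤-trans Kl≤l*nl (*-monoˡ-≤ nl (n≤1+n l)))) ⟩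
    nl * Kl + δ * (suc l * nl) ≡⟨ rearrange nl Kl δ (suc l) ⟩
    nl * (Kl + suc l * δ)      ≤⟨ *-monoʳ-≤ nl Kl+gap≤Km ⟩
    nl * Km                    ≡⟨ *-comm nl Km ⟩
    Km * nl                    ∎
    where
    open ≤-Reasoning
    rearrange : ∀ n K δ c → n * K + δ * (c * n) ≡ n * (K + c * δ)
    rearrange = solve-∀
    shift : ∀ K c δ n → K + c * δ + c * n ≡ K + c * (n + δ)
    shift = solve-∀
    Kl+gap≤Km : Kl + suc l * δ ≤ Km
    Kl+gap≤Km = +-cancelʳ-≤ (suc l * nl) _ _ (≤-trans (≤-reflexive (shift Kl (suc l) δ nl)) gap)

  module _ {d} (ks : Vec ℕ d) where

    private
      Σsizes : (ℕ → ℕ) → ℕ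
      Σsizes f = sumOver (box ks) (λ a → f ∣ a ∣ᵥ)

      Σsizes-affine : ∀ c f g → Σsizes f + c * Σsizes g ≡ Σsizes (λ s → f s + c * g s)
      Σsizes-affine c f g = trans (cong (Σsizes f +_) (sumOver-* (box ks) c (λ a → g ∣ a ∣ᵥ)))
                                  (sumOver-+ (box ks) (λ a → f ∣ a ∣ᵥ) (λ a → c * g ∣ a ∣ᵥ))

      Σsizes-mono-≤ : ∀ {f g} → (∀ s → f s ≤ g s) → Σsizes f ≤ Σsizes g
      Σsizes-mono-≤ f≤g = sumOver-mono-≤ (box ks) (λ a → f≤g ∣ a ∣ᵥ)

    KD-suc : ∀ l → KD ks (suc l) + suc l * nD ks l ≡ KD ks l + suc l * nD ks (suc l)
    KD-suc l = begin
      KD ks (suc l) + suc l * nD ks l                             ≡⟨ Σsizes-affine (suc l) (weight (suc l)) (indicator l) ⟩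
      Σsizes (λ s → weight (suc l) s + suc l * indicator l s)     ≡⟨ cong sum (map-cong (λ a → weight-suc l ∣ a ∣ᵥ) (box ks)) ⟩
      Σsizes (λ s → weight l s + suc l * indicator (suc l) s)     ≡⟨ Σsizes-affine (suc l) (weight l) (indicator (suc l)) ⟨
      KD ks l + suc l * nD ks (suc l)                             ∎
      where open ≡-Reasoning

    KD-1 : KD ks 1 ≡ nD ks 1
    KD-1 = cong sum (map-cong (λ a → weight-1 ∣ a ∣ᵥ) (box ks))

    nD≤KD : ∀ l → nD ks l ≤ KD ks l
    nD≤KD l = Σsizes-mono-≤ (indicator≤weight l)

    KD≤*nD : ∀ l → KD ks l ≤ l * nD ks l
    KD≤*nD l = begin
      KD ks l                      ≤⟨ Σsizes-mono-≤ (weight≤*indicator l) ⟩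
      Σsizes (λ s → l * indicator l s) ≡⟨ sumOver-* (box ks) l (λ a → indicator l ∣ a ∣ᵥ) ⟨
      l * nD ks l                  ∎
      where open ≤-Reasoning

    nD-mono : ∀ {l m} → l ≤ m → nD ks l ≤ nD ks m
    nD-mono l≤m = Σsizes-mono-≤ (λ s → indicator-mono s l≤m)

    KD-gap : ∀ {l m} → l ≤ m → KD ks l + suc l * nD ks m ≤ KD ks m + suc l * nD ks l
    KD-gap {l} {m} l≤m = begin
      KD ks l + suc l * nD ks m                            ≡⟨ Σsizes-affine (suc l) (weight l) (indicator m) ⟩
      Σsizes (λ s → weight l s + suc l * indicator m s)    ≤⟨ Σsizes-mono-≤ (λ s → weight-gap s l≤m) ⟩
      Σsizes (λ s → weight m s + suc l * indicator l s)    ≡⟨ Σsizes-affine (suc l) (weight m) (indicator l) ⟨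
      KD ks m + suc l * nD ks l                            ∎
      where open ≤-Reasoning

    nD-suc-< : ∀ {l} → suc l ≤ ∣ ks ∣ᵥ → nD ks l < nD ks (suc l)
    nD-suc-< {l} sl≤∣ks∣ with ∃-box-size ks sl≤∣ks∣
    ... | a , a∈box , ∣a∣≡sl =
      sumOver-mono-< (λ b → indicator-mono ∣ b ∣ᵥ (n≤1+n l)) a∈box
        (subst (λ s → indicator l s < indicator (suc l) s) (sym ∣a∣≡sl) (indicator-suc-< l))

    nD-pos : ∀ {l} → 1 ≤ l → 1 ≤ ∣ ks ∣ᵥ → 0 < nD ks l
    nD-pos 1≤l 1≤∣ks∣ = <-≤-trans (≤-<-trans z≤n (nD-suc-< 1≤∣ks∣)) (nD-mono 1≤l)

    KD-pos : ∀ {l} → 1 ≤ l → 1 ≤ ∣ ks ∣ᵥ → 0 < KD ks l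
    KD-pos {l} 1≤l 1≤∣ks∣ = <-≤-trans (nD-pos 1≤l 1≤∣ks∣) (nD≤KD l)

    nD*KD≤KD*nD : ∀ {l m} → l ≤ m → nD ks m * KD ks l ≤ KD ks m * nD ks l
    nD*KD≤KD*nD {l} {m} l≤m = mean-mono l {Km = KD ks m} (nD-mono l≤m) (KD≤*nD l) (KD-gap l≤m)

    nD*KD<KD*nD-suc : ∀ {l m} → l < m → m ≤ ∣ ks ∣ᵥ → nD ks m * KD ks l < KD ks m * nD ks (suc l)
    nD*KD<KD*nD-suc {l} {m} l<m m≤∣ks∣ = ≤-<-trans (nD*KD≤KD*nD (<⇒≤ l<m))
      (*-monoʳ-< (KD ks m) {{>-nonZero Km>0}} (nD-suc-< (≤-trans l<m m≤∣ks∣)))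
      where
      Km>0 : 0 < KD ks m
      Km>0 = KD-pos (≤-trans (s≤s z≤n) l<m) (≤-trans (s≤s z≤n) (≤-trans l<m m≤∣ks∣))

open import Data.Rational using (ℚ; 0ℚ; 1ℚ; _+_; _*_; _-_; 1/_; toℚᵘ; ≢-nonZero)
import Data.Rational.Properties as ℚ
open import Data.Rational.Unnormalised as ℚᵘ using (mkℚᵘ; *≡*)
import Data.Rational.Unnormalised.Properties as ℚᵘ
import Data.Integer as ℤ
import Data.Integer.Properties as ℤ
import Data.Integer.Tactic.RingSolver as ℤ-Solver
open import Algebra.Properties.Group ℚ.+-0-group using (x∙y⁻¹≈ε⇒x≈y)
open import Level using (0ℓ)
open import Relation.Nullary.Decidable using (dec⇒maybe)
open import Tactic.RingSolver using (solve; solve-∀)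
import Tactic.RingSolver.Core.AlmostCommutativeRing as ACR

toℚᵘ-÷ℕ : ∀ m n → toℚᵘ (m ÷ℕ suc n) ℚᵘ.≃ mkℚᵘ (ℤ.+ m) n
toℚᵘ-÷ℕ m n = ℚ.toℚᵘ-fromℚᵘ (mkℚᵘ (ℤ.+ m) n)

mkℚᵘ-+ : ∀ x y → mkℚᵘ x 0 ℚᵘ.+ mkℚᵘ y 0 ℚᵘ.≃ mkℚᵘ (x ℤ.+ y) 0
mkℚᵘ-+ x y = *≡* (lemma x y)
  where
  lemma : ∀ x y → (x ℤ.* ℤ.1ℤ ℤ.+ y ℤ.* ℤ.1ℤ) ℤ.* ℤ.1ℤ ≡ (x ℤ.+ y) ℤ.* ℤ.1ℤ
  lemma = ℤ-Solver.solve-∀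

mkℚᵘ-*-den : ∀ x n → mkℚᵘ x n ℚᵘ.* mkℚᵘ (ℤ.+ suc n) 0 ℚᵘ.≃ mkℚᵘ x 0
mkℚᵘ-*-den x n = *≡* (lemma x (ℤ.+ suc n))
  where
  lemma : ∀ x d → (x ℤ.* d) ℤ.* ℤ.1ℤ ≡ x ℤ.* (d ℤ.* ℤ.1ℤ)
  lemma = ℤ-Solver.solve-∀

ℕ→ℚ-+ : ∀ m n → ℕ→ℚ (m ℕ.+ n) ≡ ℕ→ℚ m + ℕ→ℚ n
ℕ→ℚ-+ m n = ℚ.toℚᵘ-injective (begin
  toℚᵘ (ℕ→ℚ (m ℕ.+ n))                ≈⟨ toℚᵘ-÷ℕ (m ℕ.+ n) 0 ⟩
  mkℚᵘ (ℤ.+ (m ℕ.+ n)) 0               ≡⟨ cong (λ x → mkℚᵘ x 0) (ℤ.pos-+ m n) ⟩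
  mkℚᵘ (ℤ.+ m ℤ.+ ℤ.+ n) 0             ≈⟨ mkℚᵘ-+ (ℤ.+ m) (ℤ.+ n) ⟨
  mkℚᵘ (ℤ.+ m) 0 ℚᵘ.+ mkℚᵘ (ℤ.+ n) 0   ≈⟨ ℚᵘ.+-cong (toℚᵘ-÷ℕ m 0) (toℚᵘ-÷ℕ n 0) ⟨
  toℚᵘ (ℕ→ℚ m) ℚᵘ.+ toℚᵘ (ℕ→ℚ n)      ≈⟨ ℚ.toℚᵘ-homo-+ (ℕ→ℚ m) (ℕ→ℚ n) ⟨
  toℚᵘ (ℕ→ℚ m + ℕ→ℚ n)                ∎)
  where open ℚᵘ.≃-Reasoning

ℕ→ℚ-* : ∀ m n → ℕ→ℚ (m ℕ.* n) ≡ ℕ→ℚ m * ℕ→ℚ n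
ℕ→ℚ-* m n = ℚ.toℚᵘ-injective (begin
  toℚᵘ (ℕ→ℚ (m ℕ.* n))                ≈⟨ toℚᵘ-÷ℕ (m ℕ.* n) 0 ⟩
  mkℚᵘ (ℤ.+ (m ℕ.* n)) 0               ≡⟨ cong (λ x → mkℚᵘ x 0) (ℤ.pos-* m n) ⟩
  mkℚᵘ (ℤ.+ m ℤ.* ℤ.+ n) 0             ≈⟨ *≡* refl ⟨
  mkℚᵘ (ℤ.+ m) 0 ℚᵘ.* mkℚᵘ (ℤ.+ n) 0   ≈⟨ ℚᵘ.*-cong (toℚᵘ-÷ℕ m 0) (toℚᵘ-÷ℕ n 0) ⟨
  toℚᵘ (ℕ→ℚ m) ℚᵘ.* toℚᵘ (ℕ→ℚ n)      ≈⟨ ℚ.toℚᵘ-homo-* (ℕ→ℚ m) (ℕ→ℚ n) ⟨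
  toℚᵘ (ℕ→ℚ m * ℕ→ℚ n)                ∎)
  where open ℚᵘ.≃-Reasoning

÷ℕ-*-cancel : ∀ m n → 0 < n → (m ÷ℕ n) * ℕ→ℚ n ≡ ℕ→ℚ m
÷ℕ-*-cancel m (suc n) _ = ℚ.toℚᵘ-injective (begin
  toℚᵘ ((m ÷ℕ suc n) * ℕ→ℚ (suc n))             ≈⟨ ℚ.toℚᵘ-homo-* (m ÷ℕ suc n) (ℕ→ℚ (suc n)) ⟩
  toℚᵘ (m ÷ℕ suc n) ℚᵘ.* toℚᵘ (ℕ→ℚ (suc n))    ≈⟨ ℚᵘ.*-cong (toℚᵘ-÷ℕ m n) (toℚᵘ-÷ℕ (suc n) 0) ⟩
  mkℚᵘ (ℤ.+ m) n ℚᵘ.* mkℚᵘ (ℤ.+ suc n) 0       ≈⟨ mkℚᵘ-*-den (ℤ.+ m) n ⟩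
  mkℚᵘ (ℤ.+ m) 0                                ≈⟨ toℚᵘ-÷ℕ m 0 ⟨
  toℚᵘ (ℕ→ℚ m)                                  ∎)
  where open ℚᵘ.≃-Reasoning

÷ℕ-cross : ∀ m {a} n {b} → 0 < a → 0 < b → m ÷ℕ a ≡ n ÷ℕ b → m ℕ.* b ≡ n ℕ.* a
÷ℕ-cross m {suc a} n {suc b} _ _ eq
  with ℚᵘ.≃-trans (ℚᵘ.≃-sym (toℚᵘ-÷ℕ m a)) (ℚᵘ.≃-trans (ℚ.toℚᵘ-cong eq) (toℚᵘ-÷ℕ n b))
... | *≡* cross = ℤ.+-injective (trans (ℤ.pos-* m (suc b)) (trans cross (sym (ℤ.pos-* n (suc a)))))

ℕ→ℚ-injective : ∀ {m n} → ℕ→ℚ m ≡ ℕ→ℚ n → m ≡ n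
ℕ→ℚ-injective {m} {n} eq = trans (sym (ℕ.*-identityʳ m))
  (trans (÷ℕ-cross m n (s≤s ℕ.z≤n) (s≤s ℕ.z≤n) eq) (ℕ.*-identityʳ n))

ℕ→ℚ-≢0 : ∀ n → 0 < n → ℕ→ℚ n ≢ 0ℚ
ℕ→ℚ-≢0 (suc n) _ n≡0 with ℕ→ℚ-injective {suc n} {0} n≡0
... | ()

*-cancelˡ-≢0 : ∀ {c x y : ℚ} → c ≢ 0ℚ → c * x ≡ c * y → x ≡ y
*-cancelˡ-≢0 {c} {x} {y} c≢0 cx≡cy = begin
  x                ≡⟨ ℚ.*-identityˡ x ⟨
  1ℚ * x           ≡⟨ cong (_* x) (ℚ.*-inverseˡ c) ⟨
  (1/ c * c) * x   ≡⟨ ℚ.*-assoc (1/ c) c x ⟩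
  1/ c * (c * x)   ≡⟨ cong (1/ c *_) cx≡cy ⟩
  1/ c * (c * y)   ≡⟨ ℚ.*-assoc (1/ c) c y ⟨
  (1/ c * c) * y   ≡⟨ cong (_* y) (ℚ.*-inverseˡ c) ⟩
  1ℚ * y           ≡⟨ ℚ.*-identityˡ y ⟩
  y                ∎
  where
  open ≡-Reasoning
  instance _ = ≢-nonZero c≢0

÷ℕ-unique : ∀ {r} m n → 0 < n → r * ℕ→ℚ n ≡ ℕ→ℚ m → r ≡ m ÷ℕ n
÷ℕ-unique {r} m n n>0 r*n≡m = *-cancelˡ-≢0 (ℕ→ℚ-≢0 n n>0) (begin
  ℕ→ℚ n * r          ≡⟨ ℚ.*-comm (ℕ→ℚ n) r ⟩
  r * ℕ→ℚ n          ≡⟨ trans r*n≡m (sym (÷ℕ-*-cancel m n n>0)) ⟩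
  (m ÷ℕ n) * ℕ→ℚ n   ≡⟨ ℚ.*-comm (m ÷ℕ n) (ℕ→ℚ n) ⟩
  ℕ→ℚ n * (m ÷ℕ n)   ∎)
  where open ≡-Reasoning

÷ℕ-self : ∀ {n} → 0 < n → n ÷ℕ n ≡ 1ℚ
÷ℕ-self {n} n>0 = sym (÷ℕ-unique n n n>0 (ℚ.*-identityˡ (ℕ→ℚ n)))

-- The zero test lets the solver drop cancelled monomials; without it such identities fail.
ℚ-ring : ACR.AlmostCommutativeRing 0ℓ 0ℓ
ℚ-ring = ACR.fromCommutativeRing ℚ.+-*-commutativeRing (λ x → dec⇒maybe (0ℚ ℚ.≟ x))

module Balance (a b u w x₀ x₁ y₀ y₁ c : ℚ) (u≢w : u ≢ w)
               (α-rel : (a * u + (1ℚ - a) * w) * x₀ ≡ u * x₁)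
               (β-rel : ((1ℚ - b) * w + b * u) * y₁ ≡ w * y₀)
               (step : y₁ + c * x₀ ≡ y₀ + c * x₁) where

  private
    u-w≢0 : u - w ≢ 0ℚ
    u-w≢0 u-w≡0 = u≢w (x∙y⁻¹≈ε⇒x≈y u w u-w≡0)

  q-balance : c * ((1ℚ - a) * x₀) + (1ℚ - b) * y₁ ≡ y₀
  q-balance = *-cancelˡ-≢0 u-w≢0 (begin
    (u - w) * (c * ((1ℚ - a) * x₀) + (1ℚ - b) * y₁)
      ≡⟨ solve (a ∷ b ∷ u ∷ w ∷ x₀ ∷ y₁ ∷ c ∷ []) ℚ-ring ⟩
    c * (u * x₀ - (a * u + (1ℚ - a) * w) * x₀) + (u * y₁ - ((1ℚ - b) * w + b * u) * y₁)
      ≡⟨ cong₂ (λ p q → c * (u * x₀ - p) + (u * y₁ - q)) α-rel β-rel ⟩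
    c * (u * x₀ - u * x₁) + (u * y₁ - w * y₀)
      ≡⟨ solve (u ∷ w ∷ x₀ ∷ x₁ ∷ y₀ ∷ y₁ ∷ c ∷ []) ℚ-ring ⟩
    u * (y₁ + c * x₀) - c * (u * x₁) - w * y₀
      ≡⟨ cong (λ p → u * p - c * (u * x₁) - w * y₀) step ⟩
    u * (y₀ + c * x₁) - c * (u * x₁) - w * y₀
      ≡⟨ solve (u ∷ w ∷ x₁ ∷ y₀ ∷ c ∷ []) ℚ-ring ⟩
    (u - w) * y₀ ∎)
    where open ≡-Reasoning

  t-balance : b * y₁ + c * (a * x₀) ≡ c * x₁
  t-balance = *-cancelˡ-≢0 u-w≢0 (begin
    (u - w) * (b * y₁ + c * (a * x₀))
      ≡⟨ solve (a ∷ b ∷ u ∷ w ∷ x₀ ∷ y₁ ∷ c ∷ []) ℚ-ring ⟩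
    (((1ℚ - b) * w + b * u) * y₁ - w * y₁) + c * ((a * u + (1ℚ - a) * w) * x₀ - w * x₀)
      ≡⟨ cong₂ (λ p q → (p - w * y₁) + c * (q - w * x₀)) β-rel α-rel ⟩
    (w * y₀ - w * y₁) + c * (u * x₁ - w * x₀)
      ≡⟨ solve (u ∷ w ∷ x₀ ∷ x₁ ∷ y₀ ∷ y₁ ∷ c ∷ []) ℚ-ring ⟩
    c * (u * x₁) + w * y₀ - w * (y₁ + c * x₀)
      ≡⟨ cong (λ p → c * (u * x₁) + w * y₀ - w * p) step ⟩
    c * (u * x₁) + w * y₀ - w * (y₀ + c * x₁)
      ≡⟨ solve (u ∷ w ∷ x₁ ∷ y₀ ∷ c ∷ []) ℚ-ring ⟩
    (u - w) * (c * x₁) ∎)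
    where open ≡-Reasoning

module FixedPoint {d} (ks : Vec ℕ d) (k : ℕ) (2≤k : 2 ≤ k) (k≤∣ks∣ : k ≤ V.sum ks) (α β : ℕ → ℚ)
  (hα : ∀ l → 1 ≤ l → l < k →
    (nD ks k ÷ℕ nD ks l) ≡ α l * (nD ks k ÷ℕ nD ks (suc l)) + (1ℚ - α l) * (KD ks k ÷ℕ KD ks l))
  (hβ : ∀ l → 1 < l → l < k →
    (KD ks k ÷ℕ KD ks l) ≡ (1ℚ - β l) * (KD ks k ÷ℕ KD ks (l ∸ 1)) + β l * (nD ks k ÷ℕ nD ks l))
  (hβ₁ : β 1 ≡ 1ℚ) where

  n̂ K̂ vq n-ratio K-ratio : ℕ → ℚ
  n̂ l       = ℕ→ℚ (nD ks l)
  K̂ l       = ℕ→ℚ (KD ks l)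
  vq l      = KD ks l ÷ℕ suc l
  n-ratio l = nD ks k ÷ℕ nD ks l
  K-ratio l = KD ks k ÷ℕ KD ks l

  private
    1≤∣ks∣ : 1 ≤ V.sum ks
    1≤∣ks∣ = ℕ.≤-trans (s≤s z≤n) (ℕ.≤-trans 2≤k k≤∣ks∣)

    nD>0 : ∀ {l} → 1 ≤ l → 0 < nD ks l
    nD>0 1≤l = nD-pos ks 1≤l 1≤∣ks∣

    KD>0 : ∀ {l} → 1 ≤ l → 0 < KD ks l
    KD>0 1≤l = KD-pos ks 1≤l 1≤∣ks∣

  n-ratio≢K-ratio : ∀ {l} → 1 ≤ l → suc l ≤ k → n-ratio (suc l) ≢ K-ratio l
  n-ratio≢K-ratio 1≤l sl≤k eq = ℕ.<-irrefl
    (÷ℕ-cross (nD ks k) (KD ks k) (nD>0 (s≤s z≤n)) (KD>0 1≤l) eq)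
    (nD*KD<KD*nD-suc ks sl≤k k≤∣ks∣)

  α-relation : ∀ {l} → 1 ≤ l → l < k →
    (α l * n-ratio (suc l) + (1ℚ - α l) * K-ratio l) * n̂ l ≡ n-ratio (suc l) * n̂ (suc l)
  α-relation {l} 1≤l l<k = begin
    (α l * n-ratio (suc l) + (1ℚ - α l) * K-ratio l) * n̂ l   ≡⟨ cong (_* n̂ l) (hα l 1≤l l<k) ⟨
    n-ratio l * n̂ l                                          ≡⟨ ÷ℕ-*-cancel (nD ks k) (nD ks l) (nD>0 1≤l) ⟩
    ℕ→ℚ (nD ks k)                                            ≡⟨ ÷ℕ-*-cancel (nD ks k) (nD ks (suc l)) (nD>0 (s≤s z≤n)) ⟨
    n-ratio (suc l) * n̂ (suc l)                              ∎
    where open ≡-Reasoning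

  β-relation : ∀ {l} → 1 ≤ l → suc l < k →
    ((1ℚ - β (suc l)) * K-ratio l + β (suc l) * n-ratio (suc l)) * K̂ (suc l) ≡ K-ratio l * K̂ l
  β-relation {l} 1≤l sl<k = begin
    ((1ℚ - β (suc l)) * K-ratio l + β (suc l) * n-ratio (suc l)) * K̂ (suc l)
      ≡⟨ cong (_* K̂ (suc l)) (hβ (suc l) (s≤s 1≤l) sl<k) ⟨
    K-ratio (suc l) * K̂ (suc l)   ≡⟨ ÷ℕ-*-cancel (KD ks k) (KD ks (suc l)) (KD>0 (s≤s z≤n)) ⟩
    ℕ→ℚ (KD ks k)                 ≡⟨ ÷ℕ-*-cancel (KD ks k) (KD ks l) (KD>0 1≤l) ⟨
    K-ratio l * K̂ l               ∎
    where open ≡-Reasoning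

  -- At the last level n-ratio k = 1, so the β-relation holds with β = 1.
  β-relation-last : ∀ {l} → 1 ≤ l → suc l ≡ k →
    ((1ℚ - 1ℚ) * K-ratio l + 1ℚ * n-ratio (suc l)) * K̂ (suc l) ≡ K-ratio l * K̂ l
  β-relation-last {l} 1≤l sl≡k = begin
    ((1ℚ - 1ℚ) * K-ratio l + 1ℚ * n-ratio (suc l)) * K̂ (suc l)
      ≡⟨ drop-zero (K-ratio l) (n-ratio (suc l)) (K̂ (suc l)) ⟩
    n-ratio (suc l) * K̂ (suc l)   ≡⟨ cong₂ _*_ n-ratio-last≡1 (cong K̂ sl≡k) ⟩
    1ℚ * K̂ k                      ≡⟨ ℚ.*-identityˡ (K̂ k) ⟩
    ℕ→ℚ (KD ks k)                 ≡⟨ ÷ℕ-*-cancel (KD ks k) (KD ks l) (KD>0 1≤l) ⟨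
    K-ratio l * K̂ l               ∎
    where
    open ≡-Reasoning
    drop-zero : ∀ w u y → ((1ℚ - 1ℚ) * w + 1ℚ * u) * y ≡ u * y
    drop-zero = solve-∀ ℚ-ring
    n-ratio-last≡1 : n-ratio (suc l) ≡ 1ℚ
    n-ratio-last≡1 = trans (cong (λ j → nD ks k ÷ℕ nD ks j) sl≡k) (÷ℕ-self (nD>0 (ℕ.≤-trans (s≤s z≤n) 2≤k)))

  K̂-suc : ∀ l → K̂ (suc l) + ℕ→ℚ (suc l) * n̂ l ≡ K̂ l + ℕ→ℚ (suc l) * n̂ (suc l)
  K̂-suc l = begin
    K̂ (suc l) + ℕ→ℚ (suc l) * n̂ l               ≡⟨ cong (K̂ (suc l) +_) (ℕ→ℚ-* (suc l) (nD ks l)) ⟨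
    K̂ (suc l) + ℕ→ℚ (suc l ℕ.* nD ks l)         ≡⟨ ℕ→ℚ-+ (KD ks (suc l)) (suc l ℕ.* nD ks l) ⟨
    ℕ→ℚ (KD ks (suc l) ℕ.+ suc l ℕ.* nD ks l)   ≡⟨ cong ℕ→ℚ (KD-suc ks l) ⟩
    ℕ→ℚ (KD ks l ℕ.+ suc l ℕ.* nD ks (suc l))   ≡⟨ ℕ→ℚ-+ (KD ks l) (suc l ℕ.* nD ks (suc l)) ⟩
    K̂ l + ℕ→ℚ (suc l ℕ.* nD ks (suc l))         ≡⟨ cong (K̂ l +_) (ℕ→ℚ-* (suc l) (nD ks (suc l))) ⟩
    K̂ l + ℕ→ℚ (suc l) * n̂ (suc l)               ∎
    where open ≡-Reasoning

  module BalanceAt {l} (1≤l : 1 ≤ l) (sl≤k : suc l ≤ k) (b : ℚ)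
    (β-rel : ((1ℚ - b) * K-ratio l + b * n-ratio (suc l)) * K̂ (suc l) ≡ K-ratio l * K̂ l) =
    Balance (α l) b (n-ratio (suc l)) (K-ratio l) (n̂ l) (n̂ (suc l)) (K̂ l) (K̂ (suc l)) (ℕ→ℚ (suc l))
      (n-ratio≢K-ratio 1≤l sl≤k) (α-relation 1≤l sl≤k) β-rel (K̂-suc l)

  vq-rescaled : ∀ l → vq (suc l) * ((suc (suc l) ÷ℕ suc l) * ℕ→ℚ (suc l)) ≡ K̂ (suc l)
  vq-rescaled l = trans (cong (vq (suc l) *_) (÷ℕ-*-cancel (suc (suc l)) (suc l) (s≤s z≤n)))
                        (÷ℕ-*-cancel (KD ks (suc l)) (suc (suc l)) (s≤s z≤n))

  q-inner : ∀ {l} → 1 ≤ l → suc l < k →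
    (1ℚ - α l) * n̂ l + ((l ℕ.+ 2) ÷ℕ suc l) * ((1ℚ - β (suc l)) * vq (suc l)) ≡ vq l
  q-inner {l} 1≤l sl<k = ÷ℕ-unique (KD ks l) (suc l) (s≤s z≤n) (begin
    ((1ℚ - a) * n̂ l + ((l ℕ.+ 2) ÷ℕ suc l) * ((1ℚ - b) * vq (suc l))) * c
      ≡⟨ cong (λ j → ((1ℚ - a) * n̂ l + (j ÷ℕ suc l) * ((1ℚ - b) * vq (suc l))) * c) (ℕ.+-comm l 2) ⟩
    ((1ℚ - a) * n̂ l + c′ * ((1ℚ - b) * vq (suc l))) * c
      ≡⟨ distribute a b (n̂ l) c′ (vq (suc l)) c ⟩
    c * ((1ℚ - a) * n̂ l) + (1ℚ - b) * (vq (suc l) * (c′ * c))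
      ≡⟨ cong (λ p → c * ((1ℚ - a) * n̂ l) + (1ℚ - b) * p) (vq-rescaled l) ⟩
    c * ((1ℚ - a) * n̂ l) + (1ℚ - b) * K̂ (suc l)
      ≡⟨ BalanceAt.q-balance 1≤l (ℕ.<⇒≤ sl<k) b (β-relation 1≤l sl<k) ⟩
    K̂ l ∎)
    where
    open ≡-Reasoning
    a = α l
    b = β (suc l)
    c = ℕ→ℚ (suc l)
    c′ = suc (suc l) ÷ℕ suc l
    distribute : ∀ a b x c′ e c →
      ((1ℚ - a) * x + c′ * ((1ℚ - b) * e)) * c ≡ c * ((1ℚ - a) * x) + (1ℚ - b) * (e * (c′ * c))
    distribute = solve-∀ ℚ-ring

  q-last : ∀ {l} → 1 ≤ l → suc l ≡ k → (1ℚ - α l) * n̂ l ≡ vq l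
  q-last {l} 1≤l sl≡k = ÷ℕ-unique (KD ks l) (suc l) (s≤s z≤n) (begin
    (1ℚ - α l) * n̂ l * c                            ≡⟨ pad (α l) (n̂ l) c (K̂ (suc l)) ⟩
    c * ((1ℚ - α l) * n̂ l) + (1ℚ - 1ℚ) * K̂ (suc l)  ≡⟨ BalanceAt.q-balance 1≤l sl≤k 1ℚ (β-relation-last 1≤l sl≡k) ⟩
    K̂ l                                             ∎)
    where
    open ≡-Reasoning
    c = ℕ→ℚ (suc l)
    sl≤k = ℕ.≤-reflexive sl≡k
    pad : ∀ a x c y → (1ℚ - a) * x * c ≡ c * ((1ℚ - a) * x) + (1ℚ - 1ℚ) * y
    pad = solve-∀ ℚ-ring

  t-inner : ∀ {l} → 1 ≤ l → suc l < k →
    (suc (suc l) ÷ℕ suc l) * (β (suc l) * vq (suc l)) + α l * n̂ l ≡ n̂ (suc l)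
  t-inner {l} 1≤l sl<k = *-cancelˡ-≢0 (ℕ→ℚ-≢0 (suc l) (s≤s z≤n)) (begin
    c * (c′ * (b * vq (suc l)) + a * n̂ l)     ≡⟨ distribute a b (n̂ l) c′ (vq (suc l)) c ⟩
    b * (vq (suc l) * (c′ * c)) + c * (a * n̂ l) ≡⟨ cong (λ p → b * p + c * (a * n̂ l)) (vq-rescaled l) ⟩
    b * K̂ (suc l) + c * (a * n̂ l)             ≡⟨ BalanceAt.t-balance 1≤l (ℕ.<⇒≤ sl<k) b (β-relation 1≤l sl<k) ⟩
    c * n̂ (suc l)                             ∎)
    where
    open ≡-Reasoning
    a = α l
    b = β (suc l)
    c = ℕ→ℚ (suc l)
    c′ = suc (suc l) ÷ℕ suc l
    distribute : ∀ a b x c′ e c → c * (c′ * (b * e) + a * x) ≡ b * (e * (c′ * c)) + c * (a * x)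
    distribute = solve-∀ ℚ-ring

  t-first : ℕ→ℚ 2 * (β 1 * vq 1) ≡ n̂ 1
  t-first = begin
    ℕ→ℚ 2 * (β 1 * vq 1)   ≡⟨ cong (λ b → ℕ→ℚ 2 * (b * vq 1)) hβ₁ ⟩
    ℕ→ℚ 2 * (1ℚ * vq 1)    ≡⟨ cong (ℕ→ℚ 2 *_) (ℚ.*-identityˡ (vq 1)) ⟩
    ℕ→ℚ 2 * vq 1           ≡⟨ ℚ.*-comm (ℕ→ℚ 2) (vq 1) ⟩
    vq 1 * ℕ→ℚ 2           ≡⟨ ÷ℕ-*-cancel (KD ks 1) 2 (s≤s z≤n) ⟩
    K̂ 1                    ≡⟨ cong ℕ→ℚ (KD-1 ks) ⟩
    n̂ 1                    ∎
    where open ≡-Reasoning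

  Mq-fixed : ∀ l → 1 ≤ l → l < k → Mq k α β vq n̂ l ≡ vq l
  Mq-fixed l 1≤l l<k with suc l <ᵇ k | ℕ.<ᵇ-reflects-< (suc l) k
  ... | true  | ofʸ sl<k = q-inner 1≤l sl<k
  ... | false | ofⁿ sl≮k = q-last 1≤l (ℕ.≤-antisym l<k (ℕ.≮⇒≥ sl≮k))

  Mt-fixed : ∀ l → 1 ≤ l → l < k → Mt k α β vq n̂ l ≡ n̂ l
  Mt-fixed (suc zero)    _       _   = t-first
  Mt-fixed (suc (suc l)) (s≤s _) l<k = t-inner (s≤s z≤n) l<k

theorem3p3 : (d : ℕ) → 1 ≤ d → (ks : Vec ℕ d) →
  (∀ (i : Fin d) → 1 ≤ lookup ks i) →
  (∀ (i j : Fin d) → i F.≤ j → lookup ks i ≤ lookup ks j) →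
  (k : ℕ) → 2 ≤ k → k ≤ V.sum ks →
  (α β : ℕ → ℚ) →
  (∀ l → 1 ≤ l → l < k →
    (nD ks k ÷ℕ nD ks l) ≡ α l * (nD ks k ÷ℕ nD ks (suc l)) + (1ℚ - α l) * (KD ks k ÷ℕ KD ks l)) →
  (∀ l → 1 < l → l < k →
    (KD ks k ÷ℕ KD ks l) ≡ (1ℚ - β l) * (KD ks k ÷ℕ KD ks (l ∸ 1)) + β l * (nD ks k ÷ℕ nD ks l)) →
  β 1 ≡ 1ℚ →
  ∀ l → 1 ≤ l → l < k →
    (Mq k α β (λ j → KD ks j ÷ℕ suc j) (λ j → ℕ→ℚ (nD ks j)) l ≡ KD ks l ÷ℕ suc l)
    × (Mt k α β (λ j → KD ks j ÷ℕ suc j) (λ j → ℕ→ℚ (nD ks j)) l ≡ ℕ→ℚ (nD ks l))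
theorem3p3 d _ ks _ _ k 2≤k k≤∣ks∣ α β hα hβ hβ₁ l 1≤l l<k = Mq-fixed l 1≤l l<k , Mt-fixed l 1≤l l<k
  where open FixedPoint ks k 2≤k k≤∣ks∣ α β hα hβ hβ₁
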